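{- Let $f \in \mathbb{N}_0[x^{\pm 1}]$ be such that $f(1)$ is a prime number. Then $f$ is irreducible in $\mathbb{N}_0[x^{\pm 1}]$.
   Context: $\mathbb{N}_0[x^{\pm 1}]$ denotes the commutative semiring of Laurent polynomials in $x$ with nonnegative integer coefficients. Its units are exactly the monomials $x^k$, $k \in \mathbb{Z}$. An element is irreducible if it is nonzero, not a unit, and cannot be written as a product of two non-units. $f(1)$ denotes the sum of the coefficients of $f$. -}

module Defs where

open import Data.Nat as ℕ using (ℕ; zero; suc)
open import Data.Integer as ℤ using (ℤ; +_; -[1+_])
open import Data.List using (List; []; _∷_; map)
open import Data.Nat.ListAction using (sum)
open import Data.Product using (Σ; _×_; _,_)
open import Data.Sum using (_⊎_)
open import Relation.Binary.PropositionalEquality using (_≡_)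
open import Relation.Nullary using (¬_)

-- A Laurent polynomial with coefficients in ℕ₀:
--   lp s (c₀ ∷ c₁ ∷ … ∷ cₙ ∷ [])  represents  Σᵢ cᵢ xˢ⁺ⁱ.
-- Different representations may denote the same element; equality of
-- elements is equality of coefficient functions (_≈_ below).
record LP : Set where
  constructor lp
  field
    shift  : ℤ
    coeffs : List ℕ

open LP public

nth : List ℕ → ℕ → ℕ
nth []       _       = 0
nth (c ∷ cs) zero    = c
nth (c ∷ cs) (suc i) = nth cs i

coeff : LP → ℤ → ℕ
coeff (lp s cs) n with n ℤ.- s
... | + i      = nth cs i
... | -[1+ _ ] = 0

infix 4 _≈_
_≈_ : LP → LP → Set
f ≈ g = ∀ n → coeff f n ≡ coeff g n

addL : List ℕ → List ℕ → List ℕ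
addL []       ds       = ds
addL (c ∷ cs) []       = c ∷ cs
addL (c ∷ cs) (d ∷ ds) = (c ℕ.+ d) ∷ addL cs ds

mulL : List ℕ → List ℕ → List ℕ
mulL []       ds = []
mulL (c ∷ cs) ds = addL (map (c ℕ.*_) ds) (0 ∷ mulL cs ds)

0L : LP
0L = lp (+ 0) []

1L : LP
1L = lp (+ 0) (1 ∷ [])

infixl 7 _*L_
_*L_ : LP → LP → LP
lp s cs *L lp t ds = lp (s ℤ.+ t) (mulL cs ds)

eval1 : LP → ℕ
eval1 f = sum (coeffs f)

IsUnit : LP → Set
IsUnit f = Σ LP (λ g → f *L g ≈ 1L)

Irreducible : LP → Set
Irreducible f =
  (¬ (f ≈ 0L)) × (¬ IsUnit f) ×
  (∀ g h → f ≈ g *L h → IsUnit g ⊎ IsUnit h)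

{-# OPTIONS --safe #-}
module Submission where

-- Evaluation at 1 is a semiring homomorphism ℕ₀[x^{±1}] → ℕ, and an element
-- with f(1) = 1 has a single nonzero coefficient, equal to 1, so it is a
-- monomial and hence a unit. Thus f is a unit iff f(1) = 1, and any
-- factorisation f = g h gives f(1) = g(1) h(1); when f(1) is prime one of
-- the factors evaluates to 1 and is a unit.

open import Defs
open import Data.Nat as ℕ using (ℕ; zero; suc)
import Data.Nat.Properties as ℕ
open import Algebra.Properties.CommutativeSemigroup ℕ.+-commutativeSemigroup
  using () renaming (interchange to +-interchange)
open import Data.Nat.Divisibility using (divides)
open import Data.Nat.Primality using (Prime; prime⇒irreducible; prime⇒nonZero; ¬prime[0]; ¬prime[1])
open import Data.Nat.ListAction using (sum)
open import Data.Integer as ℤ using (ℤ; +_; -[1+_]; _⊖_)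
import Data.Integer.Properties as ℤ
open import Data.Integer.Tactic.RingSolver using (solve-∀)
open import Data.List using (List; []; _∷_; _++_; map; replicate)
open import Data.Product using (Σ; _×_; _,_)
open import Data.Sum using (_⊎_; inj₁; inj₂) renaming (map to map-⊎)
open import Relation.Binary.PropositionalEquality
open import Relation.Nullary using (¬_)
open ≡-Reasoning

nthℤ : List ℕ → ℤ → ℕ
nthℤ cs (+ i)    = nth cs i
nthℤ cs -[1+ _ ] = 0

coeff-lp : ∀ s cs n → coeff (lp s cs) n ≡ nthℤ cs (n ℤ.- s)
coeff-lp s cs n with n ℤ.- s
... | + _      = refl
... | -[1+ _ ] = refl

nth≡0⇒sum≡0 : ∀ cs → (∀ i → nth cs i ≡ 0) → sum cs ≡ 0
nth≡0⇒sum≡0 []       _    = refl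
nth≡0⇒sum≡0 (c ∷ cs) cs≡0 = cong₂ ℕ._+_ (cs≡0 0) (nth≡0⇒sum≡0 cs (λ i → cs≡0 (suc i)))

sum≡0⇒nth≡0 : ∀ cs → sum cs ≡ 0 → ∀ i → nth cs i ≡ 0
sum≡0⇒nth≡0 []       _ _       = refl
sum≡0⇒nth≡0 (c ∷ cs) e zero    = ℕ.m+n≡0⇒m≡0 c e
sum≡0⇒nth≡0 (c ∷ cs) e (suc i) = sum≡0⇒nth≡0 cs (ℕ.m+n≡0⇒n≡0 c e) i

sum-cong-nth : ∀ cs ds → (∀ i → nth cs i ≡ nth ds i) → sum cs ≡ sum ds
sum-cong-nth []       ds       cs≗ds = sym (nth≡0⇒sum≡0 ds (λ i → sym (cs≗ds i)))
sum-cong-nth (c ∷ cs) []       cs≗ds = nth≡0⇒sum≡0 (c ∷ cs) cs≗ds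
sum-cong-nth (c ∷ cs) (d ∷ ds) cs≗ds =
  cong₂ ℕ._+_ (cs≗ds 0) (sum-cong-nth cs ds (λ i → cs≗ds (suc i)))

lp-cong-nth : ∀ s {cs ds} → (∀ i → nth cs i ≡ nth ds i) → lp s cs ≈ lp s ds
lp-cong-nth s {cs} {ds} cs≗ds n rewrite coeff-lp s cs n | coeff-lp s ds n with n ℤ.- s
... | + i      = cs≗ds i
... | -[1+ _ ] = refl

lp-≈⇒nth≡ : ∀ s cs ds → lp s cs ≈ lp s ds → ∀ i → nth cs i ≡ nth ds i
lp-≈⇒nth≡ s cs ds f≈g i = begin
  nth cs i                        ≡⟨ cong (nthℤ cs) (offset s (+ i)) ⟩
  nthℤ cs (s ℤ.+ + i ℤ.- s)       ≡⟨ sym (coeff-lp s cs (s ℤ.+ + i)) ⟩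
  coeff (lp s cs) (s ℤ.+ + i)     ≡⟨ f≈g (s ℤ.+ + i) ⟩
  coeff (lp s ds) (s ℤ.+ + i)     ≡⟨ coeff-lp s ds (s ℤ.+ + i) ⟩
  nthℤ ds (s ℤ.+ + i ℤ.- s)       ≡⟨ cong (nthℤ ds) (offset s (+ i)) ⟨
  nth ds i                        ∎
  where
  offset : ∀ (s m : ℤ) → m ≡ s ℤ.+ m ℤ.- s
  offset = solve-∀

pad : ℕ → List ℕ → List ℕ
pad a cs = replicate a 0 ++ cs

sum-pad : ∀ a cs → sum (pad a cs) ≡ sum cs
sum-pad zero    cs = refl
sum-pad (suc a) cs = sum-pad a cs

nth-pad : ∀ a cs i → nth (pad a cs) i ≡ nthℤ cs (i ⊖ a)
nth-pad zero    cs i       = refl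
nth-pad (suc a) cs zero    = refl
nth-pad (suc a) cs (suc i) = trans (nth-pad a cs i) (cong (nthℤ cs) (sym (ℤ.[1+m]⊖[1+n]≡m⊖n i a)))

nthℤ-pad : ∀ a cs m → nthℤ (pad a cs) m ≡ nthℤ cs (m ℤ.- + a)
nthℤ-pad a cs (+ i)     = trans (nth-pad a cs i) (cong (nthℤ cs) (sym (ℤ.[+m]-[+n]≡m⊖n i a)))
nthℤ-pad a cs -[1+ j ] = cong (nthℤ cs) (sym (below (+ j) (+ a)))
  where
  below : ∀ (x y : ℤ) → ℤ.- (+ 1 ℤ.+ x) ℤ.- y ≡ ℤ.- (+ 1 ℤ.+ (x ℤ.+ y))
  below = solve-∀

lp-pad : ∀ {s t} a cs → s ℤ.+ + a ≡ t → lp t cs ≈ lp s (pad a cs)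
lp-pad {s} a cs refl n = begin
  coeff (lp (s ℤ.+ + a) cs) n     ≡⟨ coeff-lp (s ℤ.+ + a) cs n ⟩
  nthℤ cs (n ℤ.- (s ℤ.+ + a))     ≡⟨ cong (nthℤ cs) (reassoc n s (+ a)) ⟩
  nthℤ cs (n ℤ.- s ℤ.- + a)       ≡⟨ nthℤ-pad a cs (n ℤ.- s) ⟨
  nthℤ (pad a cs) (n ℤ.- s)       ≡⟨ coeff-lp s (pad a cs) n ⟨
  coeff (lp s (pad a cs)) n       ∎
  where
  reassoc : ∀ (n s a : ℤ) → n ℤ.- (s ℤ.+ a) ≡ n ℤ.- s ℤ.- a
  reassoc = solve-∀

common-lower-shift : ∀ s t → Σ ℤ λ l → Σ ℕ λ a → Σ ℕ λ b → (l ℤ.+ + a ≡ s) × (l ℤ.+ + b ≡ t)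
common-lower-shift s t with t ℤ.- s in t-s
... | + k      = s , 0 , k , ℤ.+-identityʳ s , trans (cong (λ d → s ℤ.+ d) (sym t-s)) (cancel s t)
  where
  cancel : ∀ (s t : ℤ) → s ℤ.+ (t ℤ.- s) ≡ t
  cancel = solve-∀
... | -[1+ k ] = t , suc k , 0 , trans (cong (λ d → t ℤ.- d) (sym t-s)) (cancel s t) , ℤ.+-identityʳ t
  where
  cancel : ∀ (s t : ℤ) → t ℤ.- (t ℤ.- s) ≡ s
  cancel = solve-∀

-- Padding two representations to a common shift makes their coefficient lists
-- agree pointwise; they may still differ by trailing zeros.
eval1-cong : ∀ f g → f ≈ g → eval1 f ≡ eval1 g
eval1-cong (lp s cs) (lp t ds) f≈g with common-lower-shift s t
... | l , a , b , l+a≡s , l+b≡t = begin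
  sum cs           ≡⟨ sum-pad a cs ⟨
  sum (pad a cs)   ≡⟨ sum-cong-nth (pad a cs) (pad b ds) (lp-≈⇒nth≡ l (pad a cs) (pad b ds) padded) ⟩
  sum (pad b ds)   ≡⟨ sum-pad b ds ⟩
  sum ds           ∎
  where
  padded : lp l (pad a cs) ≈ lp l (pad b ds)
  padded n = trans (sym (lp-pad a cs l+a≡s n)) (trans (f≈g n) (lp-pad b ds l+b≡t n))

sum-addL : ∀ cs ds → sum (addL cs ds) ≡ sum cs ℕ.+ sum ds
sum-addL []       ds       = refl
sum-addL (c ∷ cs) []       = sym (ℕ.+-identityʳ (c ℕ.+ sum cs))
sum-addL (c ∷ cs) (d ∷ ds) = begin
  c ℕ.+ d ℕ.+ sum (addL cs ds)         ≡⟨ cong (c ℕ.+ d ℕ.+_) (sum-addL cs ds) ⟩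
  c ℕ.+ d ℕ.+ (sum cs ℕ.+ sum ds)      ≡⟨ +-interchange c d (sum cs) (sum ds) ⟩
  c ℕ.+ sum cs ℕ.+ (d ℕ.+ sum ds)      ∎

sum-map-* : ∀ c ds → sum (map (c ℕ.*_) ds) ≡ c ℕ.* sum ds
sum-map-* c []       = sym (ℕ.*-zeroʳ c)
sum-map-* c (d ∷ ds) = trans (cong (c ℕ.* d ℕ.+_) (sum-map-* c ds)) (sym (ℕ.*-distribˡ-+ c d (sum ds)))

sum-mulL : ∀ cs ds → sum (mulL cs ds) ≡ sum cs ℕ.* sum ds
sum-mulL []       ds = refl
sum-mulL (c ∷ cs) ds = begin
  sum (addL (map (c ℕ.*_) ds) (0 ∷ mulL cs ds))   ≡⟨ sum-addL (map (c ℕ.*_) ds) (0 ∷ mulL cs ds) ⟩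
  sum (map (c ℕ.*_) ds) ℕ.+ sum (mulL cs ds)      ≡⟨ cong₂ ℕ._+_ (sum-map-* c ds) (sum-mulL cs ds) ⟩
  c ℕ.* sum ds ℕ.+ sum cs ℕ.* sum ds              ≡⟨ ℕ.*-distribʳ-+ (sum ds) c (sum cs) ⟨
  (c ℕ.+ sum cs) ℕ.* sum ds                       ∎

eval1-* : ∀ f g → eval1 (f *L g) ≡ eval1 f ℕ.* eval1 g
eval1-* (lp _ cs) (lp _ ds) = sum-mulL cs ds

IsUnit⇒eval1≡1 : ∀ f → IsUnit f → eval1 f ≡ 1
IsUnit⇒eval1≡1 f (g , fg≈1) =
  ℕ.m*n≡1⇒m≡1 (eval1 f) (eval1 g) (trans (sym (eval1-* f g)) (eval1-cong (f *L g) 1L fg≈1))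

sum≡1⇒monomial : ∀ cs → sum cs ≡ 1 → Σ ℕ λ k → ∀ i → nth cs i ≡ nth (pad k (1 ∷ [])) i
sum≡1⇒monomial (zero ∷ cs) e with sum≡1⇒monomial cs e
... | k , cs≗xᵏ = suc k , λ { zero → refl ; (suc i) → cs≗xᵏ i }
sum≡1⇒monomial (suc zero ∷ cs) e =
  0 , λ { zero → refl ; (suc i) → sum≡0⇒nth≡0 cs (ℕ.suc-injective e) i }
sum≡1⇒monomial (suc (suc _) ∷ _) ()

nth-mulL-1 : ∀ cs i → nth (mulL cs (1 ∷ [])) i ≡ nth cs i
nth-mulL-1 []       i       = refl
nth-mulL-1 (c ∷ cs) zero    = trans (ℕ.+-identityʳ (c ℕ.* 1)) (ℕ.*-identityʳ c)
nth-mulL-1 (c ∷ cs) (suc i) = nth-mulL-1 cs i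

eval1≡1⇒IsUnit : ∀ f → eval1 f ≡ 1 → IsUnit f
eval1≡1⇒IsUnit (lp s cs) e with sum≡1⇒monomial cs e
... | k , cs≗xᵏ = lp (ℤ.- (s ℤ.+ + k)) (1 ∷ []) ,
  λ n → trans (lp-cong-nth σ (λ i → trans (nth-mulL-1 cs i) (cs≗xᵏ i)) n)
               (sym (lp-pad k (1 ∷ []) (cancel s (+ k)) n))
  where
  σ : ℤ
  σ = s ℤ.+ ℤ.- (s ℤ.+ + k)
  cancel : ∀ (s k : ℤ) → s ℤ.+ ℤ.- (s ℤ.+ k) ℤ.+ k ≡ + 0
  cancel = solve-∀

prime≡*⇒≡1 : ∀ {p m n} → Prime p → p ≡ m ℕ.* n → m ≡ 1 ⊎ n ≡ 1
prime≡*⇒≡1 {p} {m} {n} pr p≡mn with prime⇒irreducible pr (divides n (trans p≡mn (ℕ.*-comm m n)))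
... | inj₁ m≡1 = inj₁ m≡1
... | inj₂ refl =
  inj₂ (sym (ℕ.*-cancelˡ-≡ 1 n p {{prime⇒nonZero pr}} (trans (ℕ.*-identityʳ p) p≡mn)))

lemma2p1 : (f : LP) → Prime (eval1 f) → Irreducible f
lemma2p1 f pr = nonzero , nonunit , factors
  where
  nonzero : ¬ (f ≈ 0L)
  nonzero f≈0 = ¬prime[0] (subst Prime (eval1-cong f 0L f≈0) pr)

  nonunit : ¬ IsUnit f
  nonunit u = ¬prime[1] (subst Prime (IsUnit⇒eval1≡1 f u) pr)

  factors : ∀ g h → f ≈ g *L h → IsUnit g ⊎ IsUnit h
  factors g h f≈gh =
    map-⊎ (eval1≡1⇒IsUnit g) (eval1≡1⇒IsUnit h)
          (prime≡*⇒≡1 pr (trans (eval1-cong f (g *L h) f≈gh) (eval1-* g h)))
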